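{- Let $d\ge2$, $p\ge1$, $j\ge0$, $k\ge1$, and let $\chi\colon\mathcal{C}_k^{(d)}\to\mathbb{R}$ be a function depending only on generations $0,1,\dots,j$ of a tree (i.e.\ $\chi(T)=\chi(T')$ whenever $T$ and $T'$ have the same generations $0,\dots,j$). Then the function $T\mapsto N_{j+p}(T)\chi(T)$ lies in the span of the indicator functions of the length-$p$ shuffle classes in $\mathcal{C}_k^{(d)}$.
   Context: A $d$-Catalan tree is a rooted planar tree in which every vertex has $0$ or $d$ children; $\mathcal{C}_k^{(d)}$ is the set of such trees with $k$ internal vertices. Generation $i$ of a tree is the set of vertices at graph distance $i$ from the root (as a planar subtree structure), and $N_i(T)$ is the number of vertices in generation $i$ of $T$. For an ancestral path $(v_0,\dots,v_p)$ (each $v_i$ a child of $v_{i-1}$) in $T$, the shuffle class $\mathrm{Sh}(T;v_0,\dots,v_p)$ is the set of trees in $\mathcal{C}_k^{(d)}$ obtainable from $T$ by rearranging the $(d-1)p$ subtrees subtended by the siblings of $v_1,\dots,v_p$ among these sibling positions; a length-$p$ shuffle class is any such set.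
   Formalization: The function χ takes rational values instead of real ones, and the span of the indicator functions of the length-p shuffle classes is taken with rational coefficients. -}

module Defs where

open import Data.Nat using (ℕ; zero; suc; _+_)
open import Data.Fin using (Fin; zero; suc)
open import Data.Vec using (Vec; []; _∷_; toList)
open import Data.List using (List; []; _∷_; _++_; length; foldr; map)
open import Data.Maybe using (Maybe; just; nothing)
import Data.Maybe as Maybe
open import Data.Product using (Σ; ∃; _×_; _,_; proj₁; proj₂)
open import Data.Rational using (ℚ; 0ℚ; 1ℚ; _/_) renaming (_+_ to _+ℚ_; _*_ to _*ℚ_)
open import Data.Integer using (+_)
open import Data.List.Relation.Binary.Permutation.Propositional using (_↭_)
open import Data.List.Relation.Unary.All using (All)
open import Relation.Binary.PropositionalEquality using (_≡_)
open import Relation.Nullary using (¬_)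

data Tree (d : ℕ) : Set where
  leaf : Tree d
  node : Vec (Tree d) d → Tree d

mutual
  internal : ∀ {d} → Tree d → ℕ
  internal leaf = 0
  internal (node ts) = suc (internalV ts)

  internalV : ∀ {d n} → Vec (Tree d) n → ℕ
  internalV [] = 0
  internalV (t ∷ ts) = internal t + internalV ts

Ck : ℕ → ℕ → Set
Ck d k = Σ (Tree d) (λ t → internal t ≡ k)

mutual
  N : ∀ {d} → ℕ → Tree d → ℕ
  N zero t = 1
  N (suc i) leaf = 0
  N (suc i) (node ts) = NV i ts

  NV : ∀ {d n} → ℕ → Vec (Tree d) n → ℕ
  NV i [] = 0
  NV i (t ∷ ts) = N i t + NV i ts

mutual
  cut : ∀ {d} → ℕ → Tree d → Tree d
  cut zero t = leaf
  cut (suc j) leaf = leaf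
  cut (suc j) (node ts) = node (cutV j ts)

  cutV : ∀ {d n} → ℕ → Vec (Tree d) n → Vec (Tree d) n
  cutV j [] = []
  cutV j (t ∷ ts) = cut j t ∷ cutV j ts

-- Vertices are addressed by lists of child indices from the root.
-- An ancestral path (v_0,…,v_p) is given by the address a of v_0 and
-- the list ps (length p) of child indices leading from v_0 to v_p.

-- sibsP ps t : the subtrees subtended by the siblings of v_1,…,v_p
-- (in a fixed order), where v_0 is the root of t; nothing if the path
-- does not exist in t.
mutual
  sibsP : ∀ {d} → List (Fin d) → Tree d → Maybe (List (Tree d))
  sibsP [] t = just []
  sibsP (i ∷ ps) leaf = nothing
  sibsP (i ∷ ps) (node ts) = sibsPV i ps ts

  sibsPV : ∀ {d n} → Fin n → List (Fin d) → Vec (Tree d) n → Maybe (List (Tree d))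
  sibsPV zero ps (t ∷ ts) = Maybe.map (λ r → toList ts ++ r) (sibsP ps t)
  sibsPV (suc i) ps (t ∷ ts) = Maybe.map (t ∷_) (sibsPV i ps ts)

-- same, with v_0 at address a
mutual
  sibs : ∀ {d} → List (Fin d) → List (Fin d) → Tree d → Maybe (List (Tree d))
  sibs [] ps t = sibsP ps t
  sibs (i ∷ a) ps leaf = nothing
  sibs (i ∷ a) ps (node ts) = sibsV i a ps ts

  sibsV : ∀ {d n} → Fin n → List (Fin d) → List (Fin d) → Vec (Tree d) n → Maybe (List (Tree d))
  sibsV zero a ps (t ∷ ts) = sibs a ps t
  sibsV (suc i) a ps (t ∷ ts) = sibsV i a ps ts

-- refilling the sibling positions (in the same order as sibsP) from a list
fillV : ∀ {A : Set} {n} → Vec A n → List A → Vec A n × List A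
fillV [] L = [] , L
fillV (x ∷ xs) [] = x ∷ xs , []
fillV (x ∷ xs) (y ∷ L) with fillV xs L
... | ys , L' = y ∷ ys , L'

mutual
  rfP : ∀ {d} → List (Fin d) → List (Tree d) → Tree d → Tree d × List (Tree d)
  rfP [] L t = t , L
  rfP (i ∷ ps) L leaf = leaf , L
  rfP (i ∷ ps) L (node ts) with rfPV i ps L ts
  ... | ts' , L' = node ts' , L'

  rfPV : ∀ {d n} → Fin n → List (Fin d) → List (Tree d) → Vec (Tree d) n → Vec (Tree d) n × List (Tree d)
  rfPV zero ps L (t ∷ ts) with fillV ts L
  ... | us , L₁ with rfP ps L₁ t
  ... | t' , L₂ = t' ∷ us , L₂
  rfPV (suc i) ps [] (t ∷ ts) with rfPV i ps [] ts
  ... | ts' , L' = t ∷ ts' , L'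
  rfPV (suc i) ps (u ∷ L) (t ∷ ts) with rfPV i ps L ts
  ... | ts' , L' = u ∷ ts' , L'

mutual
  rf : ∀ {d} → List (Fin d) → List (Fin d) → List (Tree d) → Tree d → Tree d
  rf [] ps L t = proj₁ (rfP ps L t)
  rf (i ∷ a) ps L leaf = leaf
  rf (i ∷ a) ps L (node ts) = node (rfV i a ps L ts)

  rfV : ∀ {d n} → Fin n → List (Fin d) → List (Fin d) → List (Tree d) → Vec (Tree d) n → Vec (Tree d) n
  rfV zero a ps L (t ∷ ts) = rf a ps L t ∷ ts
  rfV (suc i) a ps L (t ∷ ts) = t ∷ rfV i a ps L ts

-- T ∈ Sh(T0; v_0,…,v_p): T is obtained from T0 by rearranging the
-- subtrees subtended by the siblings of v_1,…,v_p among these positions.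
InSh : ∀ {d} → Tree d → List (Fin d) → List (Fin d) → Tree d → Set
InSh T0 a ps T =
  ∃ λ L → sibs a ps T0 ≡ just L × (∃ λ L' → L' ↭ L × T ≡ rf a ps L' T0)

record ShuffleClass (d k p : ℕ) : Set where
  field
    T0    : Ck d k
    a     : List (Fin d)
    ps    : List (Fin d)
    len   : length ps ≡ p
    valid : ∃ λ L → sibs a ps (proj₁ T0) ≡ just L

_∈Sh_ : ∀ {d k p} → Ck d k → ShuffleClass d k p → Set
T ∈Sh S = InSh (proj₁ (ShuffleClass.T0 S)) (ShuffleClass.a S) (ShuffleClass.ps S) (proj₁ T)

IsIndicator : ∀ {A : Set} → (A → Set) → (A → ℚ) → Set
IsIndicator P f = ∀ x → (P x → f x ≡ 1ℚ) × (¬ P x → f x ≡ 0ℚ)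

InShuffleSpan : (d k p : ℕ) → (Ck d k → ℚ) → Set
InShuffleSpan d k p g =
  ∃ λ (terms : List (ℚ × ShuffleClass d k p × (Ck d k → ℚ))) →
    All (λ { (c , S , f) → IsIndicator (_∈Sh S) f }) terms ×
    (∀ T → g T ≡ foldr _+ℚ_ 0ℚ (map (λ { (c , S , f) → c *ℚ f T }) terms))

ℕtoℚ : ℕ → ℚ
ℕtoℚ n = + n / 1

-- N_{j+p}(T) counts the ancestral paths (v₀,…,v_p) of T with v₀ in generation j, that is, the pairs of
-- addresses (a, ps) ∈ Fin dʲ × Fin dᵖ present in T. Fix such a pair. The trees in which it is present are
-- partitioned into the shuffle classes Sh(T; a, ps), since being in the same shuffle class is a partial
-- equivalence, and χ is constant on each class because shuffling only moves subtrees below generation j.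
-- Hence the sum of χ(T) / |Sh(T; a, ps)| · 1_{Sh(T; a, ps)} over all T ∈ C_k^(d) is U ↦ [(a, ps) present
-- in U] · χ(U), and summing over all pairs gives N_{j+p} · χ.

module Submission where

open import Defs
open import Algebra.Bundles using (CommutativeRing)
import Algebra.Properties.Semiring.Sum as SemiringSum
open import Data.Nat as ℕ using (ℕ; zero; suc; _+_; _≤_; s≤s; NonZero)
import Data.Nat.Properties as ℕ
open import Data.Nat.Coprimality using (1-coprimeTo)
import Data.Nat.Coprimality as Coprime
import Data.Integer as ℤ
import Data.Integer.Properties as ℤ
open import Data.Rational using (ℚ; mkℚ; 0ℚ; 1ℚ; _*_; 1/_; toℚᵘ) renaming (_+_ to _+ℚ_)
open import Data.Rational.Properties
  using (normalize-coprime; toℚᵘ-injective; toℚᵘ-homo-+; +-*-commutativeRing; +-identityˡ; +-identityʳ; +-assoc;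
         *-identityˡ; *-identityʳ; *-zeroˡ; *-zeroʳ; *-assoc; *-comm; *-inverseʳ)
import Data.Rational.Unnormalised as ℚᵘ
import Data.Rational.Unnormalised.Properties as ℚᵘ
open import Data.Fin using (Fin; zero; suc)
open import Data.Vec as Vec using (Vec; []; _∷_; toList)
import Data.Vec.Properties as Vec
open import Data.List as List using (List; []; _∷_; _++_; length; [_]; concatMap; cartesianProductWith)
import Data.List.Properties as List
open import Data.Maybe as Maybe using (Maybe; just; nothing)
open import Data.Product using (∃; ∃₂; _×_; _,_; proj₁; proj₂)
open import Function using (case_of_)
open import Relation.Nullary using (Dec; yes; no; ¬_; contradiction; _×-dec_)
import Relation.Nullary.Decidable as Dec
open import Relation.Binary.Definitions using (DecidableEquality; Decidable)
open import Relation.Binary.PropositionalEquality hiding ([_])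
open import Data.List.Relation.Binary.Permutation.Propositional using (_↭_; prep; ↭-sym; ↭-trans; ↭-refl)
open import Data.List.Relation.Binary.Permutation.Propositional.Properties using (↭-length; ∈-resp-↭; shift; drop-mid)
open import Data.List.Relation.Unary.All using ([]; _∷_)
import Data.List.Relation.Unary.All.Properties as All
open import Data.List.Relation.Unary.Any as Any using (here; there; any?)
open import Data.List.Relation.Unary.Any.Properties using (lookup-index)
open import Data.List.Membership.Propositional using (_∈_)
open import Data.List.Membership.Propositional.Properties
  using (∈-∃++; ∈-map⁺; ∈-concatMap⁺; ∈-cartesianProductWith⁺)

open SemiringSum (CommutativeRing.semiring +-*-commutativeRing)
  using (sum-syntax; sum-cong-≗; *-distribʳ-sum; sum-replicate-zero)
module ℕΣ = SemiringSum ℕ.+-*-semiring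

n/1 : ℕ → ℚ
n/1 n = mkℚ (ℤ.+ n) 0 (Coprime.sym (1-coprimeTo n))

ℕtoℚ≡n/1 : ∀ n → ℕtoℚ n ≡ n/1 n
ℕtoℚ≡n/1 n = normalize-coprime (Coprime.sym (1-coprimeTo n))

ℕtoℚ-homo-+ : ∀ m n → ℕtoℚ (m + n) ≡ ℕtoℚ m +ℚ ℕtoℚ n
ℕtoℚ-homo-+ m n rewrite ℕtoℚ≡n/1 (m + n) | ℕtoℚ≡n/1 m | ℕtoℚ≡n/1 n =
  toℚᵘ-injective (ℚᵘ.≃-trans homo (ℚᵘ.≃-sym (toℚᵘ-homo-+ (n/1 m) (n/1 n))))
  where
  homo : toℚᵘ (n/1 (m + n)) ℚᵘ.≃ toℚᵘ (n/1 m) ℚᵘ.+ toℚᵘ (n/1 n)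
  homo = ℚᵘ.*≡* (trans (ℤ.*-identityʳ _) (sym (trans (ℤ.*-identityʳ _)
           (cong₂ ℤ._+_ (ℤ.*-identityʳ (ℤ.+ m)) (ℤ.*-identityʳ (ℤ.+ n))))))

-- ℕ⁻¹ 0 = 0 is a junk value.
ℕ⁻¹ : ℕ → ℚ
ℕ⁻¹ zero = 0ℚ
ℕ⁻¹ (suc n) = 1/ n/1 (suc n)

ℕtoℚ-*-ℕ⁻¹ : ∀ n .{{_ : NonZero n}} → ℕtoℚ n * ℕ⁻¹ n ≡ 1ℚ
ℕtoℚ-*-ℕ⁻¹ (suc n) = trans (cong (_* ℕ⁻¹ (suc n)) (ℕtoℚ≡n/1 (suc n))) (*-inverseʳ (n/1 (suc n)))

ℕtoℚ-*-*-ℕ⁻¹ : ∀ n x .{{_ : NonZero n}} → ℕtoℚ n * (x * ℕ⁻¹ n) ≡ x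
ℕtoℚ-*-*-ℕ⁻¹ n x = begin
  ℕtoℚ n * (x * ℕ⁻¹ n)   ≡⟨ cong (ℕtoℚ n *_) (*-comm x (ℕ⁻¹ n)) ⟩
  ℕtoℚ n * (ℕ⁻¹ n * x)   ≡⟨ *-assoc (ℕtoℚ n) (ℕ⁻¹ n) x ⟨
  ℕtoℚ n * ℕ⁻¹ n * x     ≡⟨ cong (_* x) (ℕtoℚ-*-ℕ⁻¹ n) ⟩
  1ℚ * x                 ≡⟨ *-identityˡ x ⟩
  x                      ∎
  where open ≡-Reasoning


∑-cong : ∀ {n} {f g : Fin n → ℚ} → (∀ i → f i ≡ g i) → ∑[ i < n ] f i ≡ ∑[ i < n ] g i
∑-cong = sum-cong-≗

∑-zero : ∀ n → ∑[ i < n ] 0ℚ ≡ 0ℚ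
∑-zero = sum-replicate-zero

*-distribʳ-∑ : ∀ {n} x (f : Fin n → ℚ) → (∑[ i < n ] f i) * x ≡ ∑[ i < n ] (f i * x)
*-distribʳ-∑ x f = *-distribʳ-sum x f

𝟙 : ∀ {P : Set} → Dec P → ℚ
𝟙 (yes _) = 1ℚ
𝟙 (no _) = 0ℚ

𝟙-yes : ∀ {P : Set} → P → (x : Dec P) → 𝟙 x ≡ 1ℚ
𝟙-yes p (yes _) = refl
𝟙-yes p (no ¬p) = contradiction p ¬p

𝟙-no : ∀ {P : Set} → ¬ P → (x : Dec P) → 𝟙 x ≡ 0ℚ
𝟙-no ¬p (yes p) = contradiction p ¬p
𝟙-no ¬p (no _) = refl

𝟙-isIndicator : ∀ {A : Set} {P : A → Set} (P? : ∀ x → Dec (P x)) → IsIndicator P (λ x → 𝟙 (P? x))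
𝟙-isIndicator P? x = (λ p → 𝟙-yes p (P? x)) , (λ ¬p → 𝟙-no ¬p (P? x))

𝟙ℕ : ∀ {P : Set} → Dec P → ℕ
𝟙ℕ (yes _) = 1
𝟙ℕ (no _) = 0

ℕtoℚ-𝟙ℕ : ∀ {P : Set} (x : Dec P) → ℕtoℚ (𝟙ℕ x) ≡ 𝟙 x
ℕtoℚ-𝟙ℕ (yes _) = refl
ℕtoℚ-𝟙ℕ (no _) = refl

𝟙ℕ-cong : ∀ {P Q : Set} → (P → Q) → (Q → P) → (p : Dec P) (q : Dec Q) → 𝟙ℕ p ≡ 𝟙ℕ q
𝟙ℕ-cong P→Q Q→P (yes _) (yes _) = refl
𝟙ℕ-cong P→Q Q→P (no _) (no _) = refl
𝟙ℕ-cong P→Q Q→P (yes p) (no ¬q) = contradiction (P→Q p) ¬q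
𝟙ℕ-cong P→Q Q→P (no ¬p) (yes q) = contradiction (Q→P q) ¬p

ℕtoℚ-sum : ∀ {n} (f : Fin n → ℕ) → ℕtoℚ (ℕΣ.sum f) ≡ ∑[ i < n ] ℕtoℚ (f i)
ℕtoℚ-sum {zero} f = refl
ℕtoℚ-sum {suc n} f = trans (ℕtoℚ-homo-+ (f zero) _) (cong (ℕtoℚ (f zero) +ℚ_) (ℕtoℚ-sum (λ i → f (suc i))))

count : ∀ {n} {P : Fin n → Set} → (∀ i → Dec (P i)) → ℕ
count P? = ℕΣ.sum (λ i → 𝟙ℕ (P? i))

count-nonZero : ∀ {n} {P : Fin n → Set} (P? : ∀ i → Dec (P i)) i → P i → NonZero (count P?)
count-nonZero {suc n} P? i p with P? i in eq
... | yes _ rewrite ℕΣ.sum-remove {i = i} (λ i → 𝟙ℕ (P? i)) | eq = _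
... | no ¬p = contradiction p ¬p

∑Vec : ∀ {d} j → (Vec (Fin d) j → ℚ) → ℚ
∑Vec zero f = f []
∑Vec {d} (suc j) f = ∑[ i < d ] ∑Vec j (λ v → f (i ∷ v))

∑Vec-cong : ∀ {d} j {f g : Vec (Fin d) j → ℚ} → (∀ v → f v ≡ g v) → ∑Vec j f ≡ ∑Vec j g
∑Vec-cong zero f≗g = f≗g []
∑Vec-cong (suc j) f≗g = ∑-cong (λ i → ∑Vec-cong j (λ v → f≗g (i ∷ v)))

∑Vec-zero : ∀ {d} j → ∑Vec {d} j (λ _ → 0ℚ) ≡ 0ℚ
∑Vec-zero zero = refl
∑Vec-zero {d} (suc j) = trans (∑-cong {d} (λ _ → ∑Vec-zero {d} j)) (∑-zero d)

*-distribʳ-∑Vec : ∀ {d} j x (f : Vec (Fin d) j → ℚ) → ∑Vec j f * x ≡ ∑Vec j (λ v → f v * x)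
*-distribʳ-∑Vec zero x f = refl
*-distribʳ-∑Vec (suc j) x f =
  trans (*-distribʳ-∑ x (λ i → ∑Vec j (λ v → f (i ∷ v))))
        (∑-cong (λ i → *-distribʳ-∑Vec j x (λ v → f (i ∷ v))))

-- R is a partial equivalence relation and e may list an element several times: classes are counted with
-- multiplicity, so that the weights f x / |class of x| over the class of y add up to f y.
module ClassAverage {A : Set} {R : A → A → Set} (R? : ∀ x y → Dec (R x y))
  (R-sym : ∀ {x y} → R x y → R y x) (R-trans : ∀ {x y z} → R x y → R y z → R x z)
  {n} (e : Fin n → A) (e-surjective : ∀ x → ∃ λ i → e i ≡ x)
  (f : A → ℚ) (f-resp : ∀ {x y} → R x y → f x ≡ f y) where

  classSize : A → ℕ
  classSize x = count (λ i → R? x (e i))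

  weight : A → ℚ
  weight x = f x * ℕ⁻¹ (classSize x)

  classSize-resp : ∀ {x y} → R x y → classSize x ≡ classSize y
  classSize-resp rxy = ℕΣ.sum-cong-≗ λ i →
    𝟙ℕ-cong (R-trans (R-sym rxy)) (R-trans rxy) (R? _ (e i)) (R? _ (e i))

  weight-resp : ∀ {x y} → R x y → weight x ≡ weight y
  weight-resp rxy = cong₂ (λ a b → a * ℕ⁻¹ b) (f-resp rxy) (classSize-resp rxy)

  weighted-indicator : ∀ x y → weight x * 𝟙 (R? x y) ≡ 𝟙 (R? y x) * weight y
  weighted-indicator x y with R? x y | R? y x
  ... | yes rxy | yes _ = trans (*-identityʳ (weight x)) (trans (weight-resp rxy) (sym (*-identityˡ (weight y))))
  ... | yes rxy | no ¬ryx = contradiction (R-sym rxy) ¬ryx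
  ... | no ¬rxy | yes ryx = contradiction (R-sym ryx) ¬rxy
  ... | no _ | no _ = trans (*-zeroʳ (weight x)) (sym (*-zeroˡ (weight y)))

  ∑-weighted-indicator : ∀ y → ∑[ i < n ] (weight (e i) * 𝟙 (R? (e i) y)) ≡ 𝟙 (R? y y) * f y
  ∑-weighted-indicator y with R? y y
  ... | no ¬ryy = trans (∑-cong outside) (trans (∑-zero n) (sym (*-zeroˡ (f y))))
    where
    outside : ∀ i → weight (e i) * 𝟙 (R? (e i) y) ≡ 0ℚ
    outside i with R? (e i) y
    ... | yes r = contradiction (R-trans (R-sym r) r) ¬ryy
    ... | no _ = *-zeroʳ (weight (e i))
  ... | yes ryy = begin
    ∑[ i < n ] (weight (e i) * 𝟙 (R? (e i) y)) ≡⟨ ∑-cong (λ i → weighted-indicator (e i) y) ⟩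
    ∑[ i < n ] (𝟙 (R? y (e i)) * weight y)   ≡⟨ *-distribʳ-∑ (weight y) (λ i → 𝟙 (R? y (e i))) ⟨
    (∑[ i < n ] 𝟙 (R? y (e i))) * weight y   ≡⟨ cong (_* weight y) ∑𝟙≡classSize ⟩
    ℕtoℚ (classSize y) * weight y              ≡⟨ ℕtoℚ-*-*-ℕ⁻¹ (classSize y) (f y) {{classSize-nonZero}} ⟩
    f y                                        ≡⟨ *-identityˡ (f y) ⟨
    1ℚ * f y                                   ∎
    where
    open ≡-Reasoning
    ∑𝟙≡classSize : (∑[ i < n ] 𝟙 (R? y (e i))) ≡ ℕtoℚ (classSize y)
    ∑𝟙≡classSize =
      sym (trans (ℕtoℚ-sum (λ i → 𝟙ℕ (R? y (e i)))) (∑-cong (λ i → ℕtoℚ-𝟙ℕ (R? y (e i)))))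
    classSize-nonZero : NonZero (classSize y)
    classSize-nonZero with e-surjective y
    ... | i , refl = count-nonZero (λ i → R? y (e i)) i ryy

mutual
  _≟ᵀ_ : ∀ {d} → DecidableEquality (Tree d)
  leaf ≟ᵀ leaf = yes refl
  leaf ≟ᵀ node _ = no λ ()
  node _ ≟ᵀ leaf = no λ ()
  node ts ≟ᵀ node us with ts ≟ⱽ us
  ... | yes refl = yes refl
  ... | no ts≢us = no λ { refl → ts≢us refl }

  _≟ⱽ_ : ∀ {d n} → DecidableEquality (Vec (Tree d) n)
  [] ≟ⱽ [] = yes refl
  (t ∷ ts) ≟ⱽ (u ∷ us) with t ≟ᵀ u | ts ≟ⱽ us
  ... | yes refl | yes refl = yes refl
  ... | no t≢u | _ = no λ { refl → t≢u refl }
  ... | yes _ | no ts≢us = no λ { refl → ts≢us refl }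

↭-dec : ∀ {A : Set} → DecidableEquality A → Decidable (_↭_ {A = A})
↭-dec _≟_ [] [] = yes ↭-refl
↭-dec _≟_ [] (y ∷ ys) = no λ p → ℕ.0≢1+n (↭-length p)
↭-dec _≟_ (x ∷ xs) ys with any? (x ≟_) ys
... | no x∉ys = no λ p → x∉ys (∈-resp-↭ p (here refl))
... | yes x∈ys with ∈-∃++ x∈ys
... | ws , zs , refl with ↭-dec _≟_ xs (ws ++ zs)
... | yes p = yes (↭-trans (prep x p) (↭-sym (shift x ws zs)))
... | no ¬p = no λ q → ¬p (drop-mid [] ws q)

++-split : ∀ {A : Set} m n (xs : List A) → length xs ≡ m + n →
           ∃₂ λ ys zs → xs ≡ ys ++ zs × length ys ≡ m × length zs ≡ n
++-split zero n xs eq = [] , xs , refl , refl , eq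
++-split (suc m) n (x ∷ xs) eq with ++-split m n xs (ℕ.suc-injective eq)
... | ys , zs , refl , eq₁ , eq₂ = x ∷ ys , zs , refl , cong suc eq₁ , eq₂

module _ {A : Set} where

  fillV-rest : ∀ {n} (xs : Vec A n) ys zs → length ys ≡ n → proj₂ (fillV xs (ys ++ zs)) ≡ zs
  fillV-rest [] [] zs eq = refl
  fillV-rest (x ∷ xs) (y ∷ ys) zs eq = fillV-rest xs ys zs (ℕ.suc-injective eq)

  toList-fillV : ∀ {n} (xs : Vec A n) ys zs → length ys ≡ n → toList (proj₁ (fillV xs (ys ++ zs))) ≡ ys
  toList-fillV [] [] zs eq = refl
  toList-fillV (x ∷ xs) (y ∷ ys) zs eq = cong (y ∷_) (toList-fillV xs ys zs (ℕ.suc-injective eq))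

  fillV-irrelevant : ∀ {n} (xs xs′ : Vec A n) ys zs → length ys ≡ n →
                     proj₁ (fillV xs (ys ++ zs)) ≡ proj₁ (fillV xs′ (ys ++ zs))
  fillV-irrelevant [] [] [] zs eq = refl
  fillV-irrelevant (x ∷ xs) (x′ ∷ xs′) (y ∷ ys) zs eq =
    cong (y ∷_) (fillV-irrelevant xs xs′ ys zs (ℕ.suc-injective eq))

  fillV-toList : ∀ {n} (xs : Vec A n) zs → fillV xs (toList xs ++ zs) ≡ (xs , zs)
  fillV-toList [] zs = refl
  fillV-toList (x ∷ xs) zs rewrite fillV-toList xs zs = refl

map-just : ∀ {A B : Set} {f : A → B} (m : Maybe A) {y} → Maybe.map f m ≡ just y → ∃ λ x → m ≡ just x × f x ≡ y
map-just (just x) refl = x , refl , refl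

length-toList-++ : ∀ {A : Set} {m} (xs : Vec A m) (ys zs : List A) →
                   length zs ≡ length (toList xs ++ ys) → length zs ≡ m + length ys
length-toList-++ xs ys zs eq =
  trans eq (trans (List.length-++ (toList xs)) (cong (_+ length ys) (Vec.length-toList xs)))

-- sibsP ps and rfP ps form a lens onto the sibling subtrees of the path ps (laws put-get, get-put and
-- put-put), for replacement lists of the right length; sibs and rf lift it to a path starting at address a.
module _ {d : ℕ} where

  mutual
    sibsP-rfP : ∀ ps (t : Tree d) {L} → sibsP ps t ≡ just L → ∀ (L′ : List (Tree d)) → length L′ ≡ length L →
                sibsP ps (proj₁ (rfP ps L′ t)) ≡ just L′
    sibsP-rfP [] t refl [] eq = refl
    sibsP-rfP (i ∷ ps) (node ts) sibs≡ L′ eq = sibsPV-rfPV i ps ts sibs≡ L′ eq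

    sibsPV-rfPV : ∀ {n} i ps (ts : Vec (Tree d) n) {L} → sibsPV i ps ts ≡ just L →
                  ∀ (L′ : List (Tree d)) → length L′ ≡ length L →
                  sibsPV i ps (proj₁ (rfPV i ps L′ ts)) ≡ just L′
    sibsPV-rfPV {suc m} zero ps (t ∷ ts) sibs≡ L′ eq with map-just (sibsP ps t) sibs≡
    ... | L , sibs-t≡ , refl with ++-split m (length L) L′ (length-toList-++ ts L L′ eq)
    ... | ys , zs , refl , eq₁ , eq₂
      rewrite fillV-rest ts ys zs eq₁ | sibsP-rfP ps t sibs-t≡ zs eq₂ | toList-fillV ts ys zs eq₁ = refl
    sibsPV-rfPV (suc i) ps (t ∷ ts) sibs≡ L′ eq with map-just (sibsPV i ps ts) sibs≡ | L′ | eq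
    ... | L , sibs-ts≡ , refl | u ∷ L′ | eq′ rewrite sibsPV-rfPV i ps ts sibs-ts≡ L′ (ℕ.suc-injective eq′) = refl

  mutual
    rfP-sibsP : ∀ ps (t : Tree d) {L} → sibsP ps t ≡ just L → proj₁ (rfP ps L t) ≡ t
    rfP-sibsP [] t refl = refl
    rfP-sibsP (i ∷ ps) (node ts) sibs≡ = cong node (rfPV-sibsPV i ps ts sibs≡)

    rfPV-sibsPV : ∀ {n} i ps (ts : Vec (Tree d) n) {L} → sibsPV i ps ts ≡ just L → proj₁ (rfPV i ps L ts) ≡ ts
    rfPV-sibsPV zero ps (t ∷ ts) sibs≡ with map-just (sibsP ps t) sibs≡
    ... | L , sibs-t≡ , refl rewrite fillV-toList ts L | rfP-sibsP ps t sibs-t≡ = refl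
    rfPV-sibsPV (suc i) ps (t ∷ ts) sibs≡ with map-just (sibsPV i ps ts) sibs≡
    ... | L , sibs-ts≡ , refl rewrite rfPV-sibsPV i ps ts sibs-ts≡ = refl

  mutual
    rfP-rfP : ∀ ps (t : Tree d) {L} → sibsP ps t ≡ just L → ∀ (L′ L″ : List (Tree d)) →
              length L′ ≡ length L → length L″ ≡ length L →
              proj₁ (rfP ps L″ (proj₁ (rfP ps L′ t))) ≡ proj₁ (rfP ps L″ t)
    rfP-rfP [] t refl [] [] eq′ eq″ = refl
    rfP-rfP (i ∷ ps) (node ts) sibs≡ L′ L″ eq′ eq″ = cong node (rfPV-rfPV i ps ts sibs≡ L′ L″ eq′ eq″)

    rfPV-rfPV : ∀ {n} i ps (ts : Vec (Tree d) n) {L} → sibsPV i ps ts ≡ just L → ∀ (L′ L″ : List (Tree d)) →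
                length L′ ≡ length L → length L″ ≡ length L →
                proj₁ (rfPV i ps L″ (proj₁ (rfPV i ps L′ ts))) ≡ proj₁ (rfPV i ps L″ ts)
    rfPV-rfPV {suc m} zero ps (t ∷ ts) sibs≡ L′ L″ eq′ eq″ with map-just (sibsP ps t) sibs≡
    ... | L , sibs-t≡ , refl
      with ++-split m (length L) L′ (length-toList-++ ts L L′ eq′)
         | ++-split m (length L) L″ (length-toList-++ ts L L″ eq″)
    ... | ys′ , zs′ , refl , eq₁′ , eq₂′ | ys″ , zs″ , refl , eq₁″ , eq₂″
      rewrite fillV-rest ts ys′ zs′ eq₁′ | fillV-rest (proj₁ (fillV ts (ys′ ++ zs′))) ys″ zs″ eq₁″
            | fillV-rest ts ys″ zs″ eq₁″ | fillV-irrelevant (proj₁ (fillV ts (ys′ ++ zs′))) ts ys″ zs″ eq₁″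
            | rfP-rfP ps t sibs-t≡ zs′ zs″ eq₂′ eq₂″ = refl
    rfPV-rfPV (suc i) ps (t ∷ ts) sibs≡ L′ L″ eq′ eq″
      with map-just (sibsPV i ps ts) sibs≡ | L′ | eq′ | L″ | eq″
    ... | L , sibs-ts≡ , refl | u′ ∷ L′ | eq₁ | u″ ∷ L″ | eq₂
      rewrite rfPV-rfPV i ps ts sibs-ts≡ L′ L″ (ℕ.suc-injective eq₁) (ℕ.suc-injective eq₂) = refl

  mutual
    sibs-rf : ∀ a ps (t : Tree d) {L} → sibs a ps t ≡ just L → ∀ (L′ : List (Tree d)) → length L′ ≡ length L →
              sibs a ps (rf a ps L′ t) ≡ just L′
    sibs-rf [] ps t = sibsP-rfP ps t
    sibs-rf (i ∷ a) ps (node ts) = sibsV-rfV i a ps ts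

    sibsV-rfV : ∀ {n} i a ps (ts : Vec (Tree d) n) {L} → sibsV i a ps ts ≡ just L → ∀ (L′ : List (Tree d)) →
                length L′ ≡ length L → sibsV i a ps (rfV i a ps L′ ts) ≡ just L′
    sibsV-rfV zero a ps (t ∷ ts) = sibs-rf a ps t
    sibsV-rfV (suc i) a ps (t ∷ ts) = sibsV-rfV i a ps ts

  mutual
    rf-sibs : ∀ a ps (t : Tree d) {L} → sibs a ps t ≡ just L → rf a ps L t ≡ t
    rf-sibs [] ps t = rfP-sibsP ps t
    rf-sibs (i ∷ a) ps (node ts) sibs≡ = cong node (rfV-sibsV i a ps ts sibs≡)

    rfV-sibsV : ∀ {n} i a ps (ts : Vec (Tree d) n) {L} → sibsV i a ps ts ≡ just L → rfV i a ps L ts ≡ ts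
    rfV-sibsV zero a ps (t ∷ ts) sibs≡ = cong (_∷ ts) (rf-sibs a ps t sibs≡)
    rfV-sibsV (suc i) a ps (t ∷ ts) sibs≡ = cong (t ∷_) (rfV-sibsV i a ps ts sibs≡)

  mutual
    rf-rf : ∀ a ps (t : Tree d) {L} → sibs a ps t ≡ just L → ∀ (L′ L″ : List (Tree d)) →
            length L′ ≡ length L → length L″ ≡ length L → rf a ps L″ (rf a ps L′ t) ≡ rf a ps L″ t
    rf-rf [] ps t = rfP-rfP ps t
    rf-rf (i ∷ a) ps (node ts) sibs≡ L′ L″ eq′ eq″ = cong node (rfV-rfV i a ps ts sibs≡ L′ L″ eq′ eq″)

    rfV-rfV : ∀ {n} i a ps (ts : Vec (Tree d) n) {L} → sibsV i a ps ts ≡ just L → ∀ (L′ L″ : List (Tree d)) →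
              length L′ ≡ length L → length L″ ≡ length L →
              rfV i a ps L″ (rfV i a ps L′ ts) ≡ rfV i a ps L″ ts
    rfV-rfV zero a ps (t ∷ ts) sibs≡ L′ L″ eq′ eq″ = cong (_∷ ts) (rf-rf a ps t sibs≡ L′ L″ eq′ eq″)
    rfV-rfV (suc i) a ps (t ∷ ts) sibs≡ L′ L″ eq′ eq″ =
      cong (t ∷_) (rfV-rfV i a ps ts sibs≡ L′ L″ eq′ eq″)

  mutual
    cut-rf : ∀ {j} (a : Vec (Fin d) j) ps (L : List (Tree d)) t → cut j (rf (toList a) ps L t) ≡ cut j t
    cut-rf [] ps L t = refl
    cut-rf (i ∷ a) ps L leaf = refl
    cut-rf (i ∷ a) ps L (node ts) = cong node (cutV-rfV i a ps L ts)

    cutV-rfV : ∀ {j n} i (a : Vec (Fin d) j) ps (L : List (Tree d)) (ts : Vec (Tree d) n) →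
               cutV j (rfV i (toList a) ps L ts) ≡ cutV j ts
    cutV-rfV zero a ps L (t ∷ ts) = cong (_∷ cutV _ ts) (cut-rf a ps L t)
    cutV-rfV (suc i) a ps L (t ∷ ts) = cong (cut _ t ∷_) (cutV-rfV i a ps L ts)

  module _ (a ps : List (Fin d)) where

    InSh-undefinedˡ : ∀ {t u} → sibs a ps t ≡ nothing → ¬ InSh t a ps u
    InSh-undefinedˡ undefined (_ , sibs≡ , _) = case trans (sym undefined) sibs≡ of λ ()

    InSh-undefinedʳ : ∀ {t u} → sibs a ps u ≡ nothing → ¬ InSh t a ps u
    InSh-undefinedʳ undefined (L , sibs≡ , L′ , L′↭L , refl) =
      case trans (sym undefined) (sibs-rf a ps _ sibs≡ L′ (↭-length L′↭L)) of λ ()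

    InSh-refl : ∀ {t L} → sibs a ps t ≡ just L → InSh t a ps t
    InSh-refl {L = L} sibs≡ = L , sibs≡ , L , ↭-refl , sym (rf-sibs a ps _ sibs≡)

    InSh-sym : ∀ {t u} → InSh t a ps u → InSh u a ps t
    InSh-sym {t} (L , sibs≡ , L′ , L′↭L , refl) =
      L′ , sibs-rf a ps t sibs≡ L′ |L′| , L , ↭-sym L′↭L ,
      sym (trans (rf-rf a ps t sibs≡ L′ L |L′| refl) (rf-sibs a ps t sibs≡))
      where |L′| = ↭-length L′↭L

    InSh-trans : ∀ {t u v} → InSh t a ps u → InSh u a ps v → InSh t a ps v
    InSh-trans {t} (L , sibs≡ , L′ , L′↭L , refl) (M , sibs-u≡ , M′ , M′↭M , refl)
      with trans (sym sibs-u≡) (sibs-rf a ps t sibs≡ L′ (↭-length L′↭L))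
    ... | refl = L , sibs≡ , M′ , ↭-trans M′↭M L′↭L ,
                 rf-rf a ps t sibs≡ L′ M′ (↭-length L′↭L) (trans (↭-length M′↭M) (↭-length L′↭L))

    InSh⇒refill : ∀ {t u L M} → sibs a ps t ≡ just L → sibs a ps u ≡ just M →
                  InSh t a ps u → M ↭ L × u ≡ rf a ps M t
    InSh⇒refill {t} sibs-t≡ sibs-u≡ (L , sibs≡ , L′ , L′↭L , refl)
      with trans (sym sibs-t≡) sibs≡ | trans (sym sibs-u≡) (sibs-rf a ps t sibs≡ L′ (↭-length L′↭L))
    ... | refl | refl = L′↭L , refl

    InSh? : ∀ t u → Dec (InSh t a ps u)
    InSh? t u = decide (sibs a ps t) refl (sibs a ps u) refl
      where
      decide : ∀ mt → sibs a ps t ≡ mt → ∀ mu → sibs a ps u ≡ mu → Dec (InSh t a ps u)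
      decide nothing sibs-t≡ _ _ = no (InSh-undefinedˡ sibs-t≡)
      decide (just L) _ nothing sibs-u≡ = no (InSh-undefinedʳ sibs-u≡)
      decide (just L) sibs-t≡ (just M) sibs-u≡ =
        Dec.map′ (λ (M↭L , u≡) → L , sibs-t≡ , M , M↭L , u≡) (InSh⇒refill sibs-t≡ sibs-u≡)
                 (↭-dec _≟ᵀ_ M L ×-dec (u ≟ᵀ rf a ps M t))

  Shuffles : ∀ {k} → List (Fin d) → List (Fin d) → Ck d k → Ck d k → Set
  Shuffles a ps T U = InSh (proj₁ T) a ps (proj₁ U)

  shuffles? : ∀ {k} a ps (T U : Ck d k) → Dec (Shuffles a ps T U)
  shuffles? a ps T U = InSh? a ps (proj₁ T) (proj₁ U)

  InSh-cut : ∀ {j} {t u} (a : Vec (Fin d) j) ps → InSh t (toList a) ps u → cut j t ≡ cut j u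
  InSh-cut a ps (L , sibs≡ , L′ , L′↭L , refl) = sym (cut-rf a ps L′ _)

𝟙just : ∀ {A : Set} → Maybe A → ℚ
𝟙just nothing = 0ℚ
𝟙just (just _) = 1ℚ

𝟙just-map : ∀ {A B : Set} (f : A → B) (m : Maybe A) → 𝟙just (Maybe.map f m) ≡ 𝟙just m
𝟙just-map f nothing = refl
𝟙just-map f (just _) = refl

module _ {d : ℕ} where

  ℕtoℚ-NV : ∀ {n} i (ts : Vec (Tree d) n) → ℕtoℚ (NV i ts) ≡ ∑[ f < n ] ℕtoℚ (N i (Vec.lookup ts f))
  ℕtoℚ-NV i [] = refl
  ℕtoℚ-NV i (t ∷ ts) = trans (ℕtoℚ-homo-+ (N i t) (NV i ts)) (cong (ℕtoℚ (N i t) +ℚ_) (ℕtoℚ-NV i ts))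

  𝟙just-sibsPV : ∀ {n} (i : Fin n) ps (ts : Vec (Tree d) n) →
                 𝟙just (sibsPV i ps ts) ≡ 𝟙just (sibsP ps (Vec.lookup ts i))
  𝟙just-sibsPV zero ps (t ∷ ts) = 𝟙just-map _ (sibsP ps t)
  𝟙just-sibsPV (suc i) ps (t ∷ ts) = trans (𝟙just-map _ (sibsPV i ps ts)) (𝟙just-sibsPV i ps ts)

  sibsV-lookup : ∀ {n} (i : Fin n) a ps (ts : Vec (Tree d) n) → sibsV i a ps ts ≡ sibs a ps (Vec.lookup ts i)
  sibsV-lookup zero a ps (t ∷ ts) = refl
  sibsV-lookup (suc i) a ps (t ∷ ts) = sibsV-lookup i a ps ts

  ℕtoℚ-N : ∀ p (t : Tree d) → ℕtoℚ (N p t) ≡ ∑Vec p (λ ps → 𝟙just (sibsP (toList ps) t))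
  ℕtoℚ-N zero t = refl
  ℕtoℚ-N (suc p) leaf = sym (∑Vec-zero {d} (suc p))
  ℕtoℚ-N (suc p) (node ts) = trans (ℕtoℚ-NV p ts) (∑-cong λ i →
    trans (ℕtoℚ-N p (Vec.lookup ts i)) (∑Vec-cong p λ ps → sym (𝟙just-sibsPV i (toList ps) ts)))

  ℕtoℚ-N-+ : ∀ j p (t : Tree d) →
             ℕtoℚ (N (j + p) t) ≡ ∑Vec j (λ a → ∑Vec p (λ ps → 𝟙just (sibs (toList a) (toList ps) t)))
  ℕtoℚ-N-+ zero p t = ℕtoℚ-N p t
  ℕtoℚ-N-+ (suc j) p leaf = sym (trans (∑Vec-cong {d} (suc j) (λ _ → ∑Vec-zero {d} p)) (∑Vec-zero {d} (suc j)))
  ℕtoℚ-N-+ (suc j) p (node ts) = trans (ℕtoℚ-NV (j + p) ts) (∑-cong λ i →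
    trans (ℕtoℚ-N-+ j p (Vec.lookup ts i)) (∑Vec-cong j λ a → ∑Vec-cong p λ ps →
      cong 𝟙just (sym (sibsV-lookup i (toList a) (toList ps) ts))))

  𝟙-InSh-refl : ∀ a ps (t : Tree d) → 𝟙 (InSh? a ps t t) ≡ 𝟙just (sibs a ps t)
  𝟙-InSh-refl a ps t = from-sibs (sibs a ps t) refl
    where
    from-sibs : ∀ m → sibs a ps t ≡ m → 𝟙 (InSh? a ps t t) ≡ 𝟙just m
    from-sibs nothing sibs≡ = 𝟙-no (InSh-undefinedʳ a ps sibs≡) (InSh? a ps t t)
    from-sibs (just L) sibs≡ = 𝟙-yes (InSh-refl a ps sibs≡) (InSh? a ps t t)

vecsOver : ∀ {A : Set} n → List A → List (Vec A n)
vecsOver zero xs = [ [] ]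
vecsOver (suc n) xs = cartesianProductWith _∷_ xs (vecsOver n xs)

module _ {d : ℕ} where

  treesUpTo : ℕ → List (Tree d)
  treesUpTo zero = [ leaf ]
  treesUpTo (suc h) = leaf ∷ List.map node (vecsOver d (treesUpTo h))

  mutual
    ∈-treesUpTo : ∀ h (t : Tree d) → internal t ≤ h → t ∈ treesUpTo h
    ∈-treesUpTo zero leaf _ = here refl
    ∈-treesUpTo (suc h) leaf _ = here refl
    ∈-treesUpTo (suc h) (node ts) (s≤s ≤h) = there (∈-map⁺ node (∈-vecsOver-treesUpTo h ts ≤h))

    ∈-vecsOver-treesUpTo : ∀ {n} h (ts : Vec (Tree d) n) → internalV ts ≤ h → ts ∈ vecsOver n (treesUpTo h)
    ∈-vecsOver-treesUpTo h [] _ = here refl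
    ∈-vecsOver-treesUpTo h (t ∷ ts) ≤h = ∈-cartesianProductWith⁺ _∷_
      (∈-treesUpTo h t (ℕ.m+n≤o⇒m≤o (internal t) ≤h))
      (∈-vecsOver-treesUpTo h ts (ℕ.m+n≤o⇒n≤o (internal t) ≤h))

  asCk : ∀ {k} (t : Tree d) → Dec (internal t ≡ k) → List (Ck d k)
  asCk t (yes eq) = [ t , eq ]
  asCk t (no _) = []

  ∈-asCk : ∀ {k} {t : Tree d} (eq : internal t ≡ k) (eq? : Dec (internal t ≡ k)) → (t , eq) ∈ asCk t eq?
  ∈-asCk eq (yes eq′) = here (cong (_ ,_) (ℕ.≡-irrelevant eq eq′))
  ∈-asCk eq (no ¬eq) = contradiction eq ¬eq

  allCk : ∀ k → List (Ck d k)
  allCk k = concatMap (λ t → asCk t (internal t ℕ.≟ k)) (treesUpTo k)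

  ∈-allCk : ∀ {k} (T : Ck d k) → T ∈ allCk k
  ∈-allCk {k} (t , eq) = ∈-concatMap⁺ _ (Any.map (λ { refl → ∈-asCk eq (internal t ℕ.≟ k) })
                                                 (∈-treesUpTo k t (ℕ.≤-reflexive eq)))

foldr-+ℚ-map-++ : ∀ {X : Set} (φ : X → ℚ) xs ys →
  List.foldr _+ℚ_ 0ℚ (List.map φ (xs ++ ys)) ≡
  List.foldr _+ℚ_ 0ℚ (List.map φ xs) +ℚ List.foldr _+ℚ_ 0ℚ (List.map φ ys)
foldr-+ℚ-map-++ φ [] ys = sym (+-identityˡ _)
foldr-+ℚ-map-++ φ (x ∷ xs) ys = trans (cong (φ x +ℚ_) (foldr-+ℚ-map-++ φ xs ys)) (sym (+-assoc (φ x) _ _))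

module ShuffleSpan (d k p : ℕ) where

  span-0 : InShuffleSpan d k p (λ _ → 0ℚ)
  span-0 = [] , [] , λ _ → refl

  span-≗ : ∀ {g h} → InShuffleSpan d k p g → (∀ T → g T ≡ h T) → InShuffleSpan d k p h
  span-≗ (terms , indicators , g≡) g≗h = terms , indicators , λ T → trans (sym (g≗h T)) (g≡ T)

  span-+ : ∀ {g h} → InShuffleSpan d k p g → InShuffleSpan d k p h → InShuffleSpan d k p (λ T → g T +ℚ h T)
  span-+ (terms , indicators , g≡) (terms′ , indicators′ , h≡) =
    terms ++ terms′ , All.++⁺ indicators indicators′ ,
    λ T → trans (cong₂ _+ℚ_ (g≡ T) (h≡ T)) (sym (foldr-+ℚ-map-++ _ terms terms′))

  span-scaled-indicator : ∀ c (S : ShuffleClass d k p) f → IsIndicator (_∈Sh S) f →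
                          InShuffleSpan d k p (λ T → c * f T)
  span-scaled-indicator c S f f-indicator = [ c , S , f ] , f-indicator ∷ [] , λ T → sym (+-identityʳ _)

  span-∑ : ∀ {n} (g : Fin n → Ck d k → ℚ) → (∀ i → InShuffleSpan d k p (g i)) →
           InShuffleSpan d k p (λ T → ∑[ i < n ] g i T)
  span-∑ {zero} g g-span = span-0
  span-∑ {suc n} g g-span = span-+ (g-span zero) (span-∑ (λ i → g (suc i)) (λ i → g-span (suc i)))

  span-∑Vec : ∀ j (g : Vec (Fin d) j → Ck d k → ℚ) → (∀ v → InShuffleSpan d k p (g v)) →
              InShuffleSpan d k p (λ T → ∑Vec j (λ v → g v T))
  span-∑Vec zero g g-span = g-span []
  span-∑Vec (suc j) g g-span = span-∑ _ (λ i → span-∑Vec j (λ v → g (i ∷ v)) (λ v → g-span (i ∷ v)))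

  span-scaled-shuffles : ∀ a (ps : Vec (Fin d) p) c (T : Ck d k) →
                     InShuffleSpan d k p (λ U → c * 𝟙 (shuffles? a (toList ps) T U))
  span-scaled-shuffles a ps c T = from-sibs (sibs a (toList ps) (proj₁ T)) refl
    where
    from-sibs : ∀ m → sibs a (toList ps) (proj₁ T) ≡ m →
                InShuffleSpan d k p (λ U → c * 𝟙 (shuffles? a (toList ps) T U))
    from-sibs nothing sibs≡ = span-≗ span-0 λ U →
      sym (trans (cong (c *_) (𝟙-no (InSh-undefinedˡ a (toList ps) sibs≡) (shuffles? a (toList ps) T U))) (*-zeroʳ c))
    from-sibs (just L) sibs≡ = span-scaled-indicator c S _ (𝟙-isIndicator (shuffles? a (toList ps) T))
      where
      S : ShuffleClass d k p
      S = record { T0 = T ; a = a ; ps = toList ps ; len = Vec.length-toList ps ; valid = L , sibs≡ }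

module ShuffleAveraging (d p j k : ℕ) (χ : Ck d k → ℚ)
  (χ-local : ∀ T T' → cut j (proj₁ T) ≡ cut j (proj₁ T') → χ T ≡ χ T') where

  open ShuffleSpan d k p

  n : ℕ
  n = length (allCk {d} k)

  e : Fin n → Ck d k
  e = List.lookup (allCk k)

  e-surjective : ∀ U → ∃ λ i → e i ≡ U
  e-surjective U = Any.index (∈-allCk U) , sym (lookup-index (∈-allCk U))

  module Average (a : Vec (Fin d) j) (ps : Vec (Fin d) p) = ClassAverage
    (shuffles? (toList a) (toList ps)) (InSh-sym (toList a) (toList ps)) (InSh-trans (toList a) (toList ps))
    e e-surjective χ (λ r → χ-local _ _ (InSh-cut a (toList ps) r))

  shuffleAverage : Ck d k → ℚ
  shuffleAverage U = ∑Vec j λ a → ∑Vec p λ ps → ∑[ i < n ]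
    (Average.weight a ps (e i) * 𝟙 (shuffles? (toList a) (toList ps) (e i) U))

  shuffleAverage-inSpan : InShuffleSpan d k p shuffleAverage
  shuffleAverage-inSpan = span-∑Vec j _ λ a → span-∑Vec p _ λ ps → span-∑ _ λ i →
    span-scaled-shuffles (toList a) ps (Average.weight a ps (e i)) (e i)

  shuffleAverage≡N*χ : ∀ U → shuffleAverage U ≡ ℕtoℚ (N (j + p) (proj₁ U)) * χ U
  shuffleAverage≡N*χ U = begin
    shuffleAverage U
      ≡⟨ ∑Vec-cong j (λ a → ∑Vec-cong p (λ ps → Average.∑-weighted-indicator a ps U)) ⟩
    ∑Vec j (λ a → ∑Vec p (λ ps → 𝟙 (shuffles? (toList a) (toList ps) U U) * χ U))
      ≡⟨ ∑Vec-cong j (λ a → ∑Vec-cong p (λ ps →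
           cong (_* χ U) (𝟙-InSh-refl (toList a) (toList ps) (proj₁ U)))) ⟩
    ∑Vec j (λ a → ∑Vec p (λ ps → path-present a ps * χ U))
      ≡⟨ trans (*-distribʳ-∑Vec j (χ U) _) (∑Vec-cong j (λ a → *-distribʳ-∑Vec p (χ U) (path-present a))) ⟨
    ∑Vec j (λ a → ∑Vec p (λ ps → path-present a ps)) * χ U
      ≡⟨ cong (_* χ U) (ℕtoℚ-N-+ j p (proj₁ U)) ⟨
    ℕtoℚ (N (j + p) (proj₁ U)) * χ U ∎
    where
    open ≡-Reasoning
    path-present : Vec (Fin d) j → Vec (Fin d) p → ℚ
    path-present a ps = 𝟙just (sibs (toList a) (toList ps) (proj₁ U))

lemma6p2 : (d p j k : ℕ) → 2 ≤ d → 1 ≤ p → 1 ≤ k →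
    (χ : Ck d k → ℚ) →
    (∀ T T' → cut j (proj₁ T) ≡ cut j (proj₁ T') → χ T ≡ χ T') →
    InShuffleSpan d k p (λ T → ℕtoℚ (N (j + p) (proj₁ T)) * χ T)
lemma6p2 d p j k _ _ _ χ χ-local = ShuffleSpan.span-≗ d k p shuffleAverage-inSpan shuffleAverage≡N*χ
  where open ShuffleAveraging d p j k χ χ-local
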